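{- Let $\mathcal{P}$ be the conjunction of population protocols $\mathcal{P}_1$ and $\mathcal{P}_2$ (defined in the context). For every configuration $C$ of $\mathcal{P}$, if $C$ is terminal in $\mathcal{P}$, then $\pi_1(C)$ is terminal in $\mathcal{P}_1$ and $\pi_2(C)$ is terminal in $\mathcal{P}_2$.
   Context: A population over finite $E$ is $M : E\to\mathbb{N}$ with $\sum_e M(e)\ge 2$. A population protocol is $(Q,T,\Sigma,I,O)$ with $T\subseteq Q^2\times Q^2$ containing for each $(p,q)$ some $(p,q,p',q')$, $I:\Sigma\to Q$, $O:Q\to\{0,1\}$; configurations are populations over $Q$; a transition $(p,q)\mapsto(p',q')$ is enabled at $C$ if $C$ contains the multiset $\{p,q\}$, leading to $C-\{p,q\}+\{p',q'\}$; $C$ is terminal if every configuration reachable from $C$ equals $C$. Let $\mathcal{P}_1 = (Q_1,T_1,\Sigma,I_1,O_1)$, $\mathcal{P}_2 = (Q_2,T_2,\Sigma,I_2,O_2)$. Their conjunction is $\mathcal{P} = (Q_1\times Q_2, S_1\cup S_2, \Sigma, I, O)$ with $I(\sigma) = (I_1(\sigma),I_2(\sigma))$, $O(p,q)=O_1(p)\wedge O_2(q)$, $S_1 = \{((p,r),(p',r'))\mapsto((q,r),(q',r')) : (p,p',q,q')\in T_1,\ r,r'\in Q_2\}$, $S_2 = \{((r,p),(r',p'))\mapsto((r,q),(r',q')) : (p,p',q,q')\in T_2,\ r,r'\in Q_1\}$. For a configuration $C$ of $\mathcal{P}$ and $i\in\{1,2\}$, $\pi_i(C)$ is the configuration of $\mathcal{P}_i$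 with $\pi_i(C)(q) = \sum_{r\in Q_1\times Q_2 :\, r_i = q} C(r)$, where $r_i$ is the $i$-th component of $r$. -}

module Defs where

open import Level using (Level; _⊔_) renaming (suc to lsuc; zero to lzero)
open import Data.Nat using (ℕ; zero; suc; _+_; _∸_; _≤_)
open import Data.Bool using (Bool; _∧_)
open import Data.List using (List; map; cartesianProduct)
open import Data.Nat.ListAction using (sum)
open import Data.List.Membership.Propositional using (_∈_)
open import Data.List.Relation.Unary.Unique.Propositional using (Unique)
open import Data.Product using (_×_; _,_; proj₁; proj₂; ∃₂)
open import Data.Sum using (_⊎_)
open import Relation.Binary.PropositionalEquality using (_≡_)
open import Relation.Binary.Definitions using (DecidableEquality)
open import Relation.Binary.Construct.Closure.ReflexiveTransitive using (Star)
open import Relation.Nullary.Decidable using (⌊_⌋)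

record FinSet : Set₁ where
  field
    Carrier  : Set
    _≟_      : DecidableEquality Carrier
    enum     : List Carrier
    complete : ∀ x → x ∈ enum
    unique   : Unique enum

open FinSet public

Multiset : FinSet → Set
Multiset E = Carrier E → ℕ

size : (E : FinSet) → Multiset E → ℕ
size E M = sum (map M (enum E))

IsPopulation : (E : FinSet) → Multiset E → Set
IsPopulation E M = 2 ≤ size E M

δ : (E : FinSet) → Carrier E → Carrier E → ℕ
δ E p x with ⌊ (_≟_ E) x p ⌋
... | Data.Bool.true  = 1
... | Data.Bool.false = 0

pair : (E : FinSet) → Carrier E → Carrier E → Multiset E
pair E p q x = δ E p x + δ E q x

-- A population protocol (Q, T, Σ, I, O); T is given as a relation
-- T p q p' q'  meaning  (p,q,p',q') ∈ T.
record Protocol (Q : FinSet) (Σ : Set) : Set₁ where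
  field
    T     : Carrier Q → Carrier Q → Carrier Q → Carrier Q → Set
    total : ∀ p q → ∃₂ λ p' q' → T p q p' q'
    I     : Σ → Carrier Q
    O     : Carrier Q → Bool

open Protocol public

-- Configurations of a protocol with state set Q are multisets over Q
-- (the population condition is imposed where needed; it is preserved by steps).
Config : FinSet → Set
Config Q = Multiset Q

Step : ∀ {Q Σ} → Protocol Q Σ → Config Q → Config Q → Set
Step {Q} P C C' =
  ∃₂ λ p q → ∃₂ λ p' q' →
    T P p q p' q' ×
    (∀ x → pair Q p q x ≤ C x) ×
    (∀ x → C' x ≡ (C x ∸ pair Q p q x) + pair Q p' q' x)

Reach : ∀ {Q Σ} → Protocol Q Σ → Config Q → Config Q → Set
Reach P = Star (Step P)

Terminal : ∀ {Q Σ} → Protocol Q Σ → Config Q → Set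
Terminal {Q} P C = ∀ D → Reach P C D → ∀ x → D x ≡ C x

_×ᶠ_ : FinSet → FinSet → FinSet
Q₁ ×ᶠ Q₂ = record
  { Carrier  = Carrier Q₁ × Carrier Q₂
  ; _≟_      = Data.Product.Properties.≡-dec (_≟_ Q₁) (_≟_ Q₂)
  ; enum     = cartesianProduct (enum Q₁) (enum Q₂)
  ; complete = λ { (a , b) → Data.List.Membership.Propositional.Properties.∈-cartesianProduct⁺ (complete Q₁ a) (complete Q₂ b) }
  ; unique   = Data.List.Relation.Unary.Unique.Propositional.Properties.cartesianProduct⁺ (unique Q₁) (unique Q₂)
  }
  where
  import Data.Product.Properties
  import Data.List.Membership.Propositional.Properties
  import Data.List.Relation.Unary.Unique.Propositional.Properties

conj : ∀ {Q₁ Q₂ Σ} → Protocol Q₁ Σ → Protocol Q₂ Σ → Protocol (Q₁ ×ᶠ Q₂) Σ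
conj {Q₁} {Q₂} P₁ P₂ = record
  { T     = S
  ; total = λ { (p , r) (p' , r') → tot p r p' r' }
  ; I     = λ σ → I P₁ σ , I P₂ σ
  ; O     = λ { (p , q) → O P₁ p ∧ O P₂ q }
  }
  where
  S : Carrier (Q₁ ×ᶠ Q₂) → Carrier (Q₁ ×ᶠ Q₂) → Carrier (Q₁ ×ᶠ Q₂) → Carrier (Q₁ ×ᶠ Q₂) → Set
  S (p , r) (p' , r') (q , s) (q' , s') =
    (T P₁ p p' q q' × s ≡ r × s' ≡ r') ⊎ (T P₂ r r' s s' × q ≡ p × q' ≡ p')
  tot : ∀ p r p' r' → ∃₂ λ x y → S (p , r) (p' , r') x y
  tot p r p' r' with total P₁ p p'
  ... | (q , q' , t) = (q , r) , (q' , r') , Data.Sum.inj₁ (t , Relation.Binary.PropositionalEquality.refl , Relation.Binary.PropositionalEquality.refl)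

π₁ : ∀ {Q₁ Q₂} → Config (Q₁ ×ᶠ Q₂) → Config Q₁
π₁ {Q₁} {Q₂} C q = sum (map (λ r → C (q , r)) (enum Q₂))

π₂ : ∀ {Q₁ Q₂} → Config (Q₁ ×ᶠ Q₂) → Config Q₂
π₂ {Q₁} {Q₂} C q = sum (map (λ r → C (r , q)) (enum Q₁))

-- A transition (p, p') ↦ (q, q') of P₁ enabled at π₁(C) lifts to a transition
-- ((p, r), (p', r')) ↦ ((q, r), (q', r')) of the conjunction enabled at C: pick
-- P₂-components r, r' present in C (two distinct agents when p = p'). Since C is
-- terminal, the lifted transition leaves the multiset {(p, r), (p', r')} unchanged,
-- so {q, q'} = {p, p'} and the original step does not change π₁(C). A configuration
-- whose steps all leave it unchanged is terminal. The case of π₂ is symmetric.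
module Submission where

open import Defs
open import Data.Empty using (⊥-elim)
open import Data.List using ([]; _∷_; map)
open import Data.List.Membership.Propositional using (find)
open import Data.List.Relation.Unary.All using (lookup)
open import Data.List.Relation.Unary.Any using (Any; here; there; satisfied)
open import Data.List.Relation.Unary.Unique.Propositional using (Unique; _∷_)
open import Data.Nat using (ℕ; zero; suc; _+_; _∸_; _≤_; z≤n; s≤s; s≤s⁻¹)
open import Data.Nat.ListAction using (sum)
open import Data.Nat.Properties using (+-comm; +-cancelˡ-≡; m∸n+n≡m; m≤n+m; ≤-trans)
open import Data.Product using (_×_; _,_; ∃; ∃₂)
open import Data.Product.Properties using (,-injectiveˡ; ,-injectiveʳ)
open import Data.Sum using (_⊎_; inj₁; inj₂)
open import Function using (_∘_; flip)
open import Relation.Nullary using (yes; no)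
open import Relation.Binary.PropositionalEquality
open import Relation.Binary.Construct.Closure.ReflexiveTransitive using (ε; _◅_)

_≤ᵐ_ : {A : Set} → (A → ℕ) → (A → ℕ) → Set
M ≤ᵐ N = ∀ x → M x ≤ N x

SamePair : {A : Set} → A → A → A → A → Set
SamePair a b c d = (a ≡ c × b ≡ d) ⊎ (a ≡ d × b ≡ c)

module _ (E : FinSet) where

  δ-refl : ∀ a → δ E a a ≡ 1
  δ-refl a with _≟_ E a a
  ... | yes _   = refl
  ... | no a≢a = ⊥-elim (a≢a refl)

  δ-injective : ∀ {a b} → δ E a ≗ δ E b → a ≡ b
  δ-injective {a} {b} δa≗δb = from-δ (trans (sym (δ-refl a)) (δa≗δb a))
    where
    from-δ : 1 ≡ δ E b a → a ≡ b
    from-δ 1≡δba with _≟_ E a b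
    ... | yes a≡b = a≡b
    from-δ () | no _

  pair-cong : ∀ {a b c d} → SamePair a b c d → pair E a b ≗ pair E c d
  pair-cong (inj₁ (refl , refl)) x = refl
  pair-cong {a} {b} (inj₂ (refl , refl)) x = +-comm (δ E a x) (δ E b x)

  pair-injective : ∀ {a b c d} → pair E a b ≗ pair E c d → SamePair a b c d
  pair-injective {a} {b} {c} {d} ab≗cd with _≟_ E a c | _≟_ E a d
  ... | yes refl | _ = inj₁ (refl , δ-injective (λ x → +-cancelˡ-≡ (δ E a x) _ _ (ab≗cd x)))
  ... | no _ | yes refl = inj₂ (refl , δ-injective (λ x →
        +-cancelˡ-≡ (δ E a x) _ _ (trans (ab≗cd x) (+-comm (δ E c x) (δ E a x)))))
  ... | no a≢c | no a≢d = ⊥-elim (absurd (trans (sym (cong (_+ δ E b a) (δ-refl a))) (ab≗cd a)))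
    where
    absurd : 1 + δ E b a ≢ pair E c d a
    absurd eq with _≟_ E a c | _≟_ E a d
    ... | yes a≡c | _ = a≢c a≡c
    ... | no _ | yes a≡d = a≢d a≡d
    absurd () | no _ | no _

  pair-diag-≤ : ∀ {M a} → 2 ≤ M a → pair E a a ≤ᵐ M
  pair-diag-≤ {a = a} 2≤Ma x with _≟_ E x a
  ... | yes refl = 2≤Ma
  ... | no _     = z≤n

  pair-≢-≤ : ∀ {M a b} → a ≢ b → 1 ≤ M a → 1 ≤ M b → pair E a b ≤ᵐ M
  pair-≢-≤ {a = a} {b} a≢b 1≤Ma 1≤Mb x with _≟_ E x a | _≟_ E x b
  ... | yes refl | yes refl = ⊥-elim (a≢b refl)
  ... | yes refl | no _     = 1≤Ma
  ... | no _     | yes refl = 1≤Mb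
  ... | no _     | no _     = z≤n

  pair-diag-≤⁻ : ∀ {M a} → pair E a a ≤ᵐ M → 2 ≤ M a
  pair-diag-≤⁻ {M} {a} aa≤M = subst (_≤ M a) (cong₂ _+_ (δ-refl a) (δ-refl a)) (aa≤M a)

  pair-≤⁻ : ∀ {M a b} → pair E a b ≤ᵐ M → 1 ≤ M a × 1 ≤ M b
  pair-≤⁻ {a = a} {b} ab≤M =
    ≤-trans (subst (λ n → 1 ≤ n + δ E b a) (sym (δ-refl a)) (s≤s z≤n)) (ab≤M a) ,
    ≤-trans (subst (λ n → 1 ≤ δ E a b + n) (sym (δ-refl b)) (m≤n+m 1 (δ E a b))) (ab≤M b)

sum-positive : ∀ {A : Set} (f : A → ℕ) xs → 1 ≤ sum (map f xs) → Any (λ x → 1 ≤ f x) xs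
sum-positive f [] ()
sum-positive f (x ∷ xs) 1≤sum with f x in fx≡
... | suc _ = here (subst (1 ≤_) (sym fx≡) (s≤s z≤n))
... | zero  = there (sum-positive f xs 1≤sum)

sum-≥2 : ∀ {A : Set} (f : A → ℕ) xs → Unique xs → 2 ≤ sum (map f xs) →
         (∃ λ x → 2 ≤ f x) ⊎ (∃₂ λ x y → x ≢ y × 1 ≤ f x × 1 ≤ f y)
sum-≥2 f [] _ ()
sum-≥2 f (x ∷ xs) (x≢xs ∷ xs-unique) 2≤sum with f x in fx≡
... | zero        = sum-≥2 f xs xs-unique 2≤sum
... | suc (suc _) = inj₁ (x , subst (2 ≤_) (sym fx≡) (s≤s (s≤s z≤n)))
... | suc zero with find (sum-positive f xs (s≤s⁻¹ 2≤sum))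
...   | y , y∈xs , 1≤fy = inj₂ (x , y , lookup x≢xs y∈xs , subst (1 ≤_) (sym fx≡) (s≤s z≤n) , 1≤fy)

module _ {Q : FinSet} {Σ : Set} (P : Protocol Q Σ) where

  terminal-if-steps-trivial : ∀ {K} → (∀ {X Y} → X ≗ K → Step P X Y → Y ≗ K) → Terminal P K
  terminal-if-steps-trivial {K} step-trivial D = go (λ _ → refl)
    where
    go : ∀ {X} → X ≗ K → Reach P X D → D ≗ K
    go X≗K ε        = X≗K
    go X≗K (s ◅ ss) = go (step-trivial X≗K s) ss

  step-trivial-if-pair-preserved : ∀ {X Y p p' q q'} → pair Q p p' ≤ᵐ X →
    (∀ x → Y x ≡ X x ∸ pair Q p p' x + pair Q q q' x) → pair Q p p' ≗ pair Q q q' → Y ≗ X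
  step-trivial-if-pair-preserved {X} {p = p} {p'} enabled Y≡ preserved x =
    trans (Y≡ x) (trans (cong (X x ∸ pair Q p p' x +_) (sym (preserved x))) (m∸n+n≡m (enabled x)))

  terminal-preserves-pair : ∀ {C a b c d} → Terminal P C → T P a b c d → pair Q a b ≤ᵐ C →
                            pair Q a b ≗ pair Q c d
  terminal-preserves-pair {C} {a} {b} {c} {d} terminal t enabled x =
    +-cancelˡ-≡ (C x ∸ pair Q a b x) _ _
      (trans (m∸n+n≡m (enabled x)) (sym (terminal _ (step ◅ ε) x)))
    where
    step : Step P C (λ y → C y ∸ pair Q a b y + pair Q c d y)
    step = a , b , c , d , t , enabled , λ _ → refl

module _ {Q Q' : FinSet} (R : FinSet) (ι : Carrier Q → Carrier R → Carrier Q')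
         (ι-injectiveˡ : ∀ {p q r s} → ι p r ≡ ι q s → p ≡ q)
         (ι-injectiveʳ : ∀ {p q r s} → ι p r ≡ ι q s → r ≡ s) where

  -- With ι = _,_ this is π₁, with ι = flip _,_ it is π₂.
  project : Config Q' → Config Q
  project C q = sum (map (λ r → C (ι q r)) (enum R))

  enabled-lift : ∀ {C p p'} → pair Q p p' ≤ᵐ project C →
                 ∃₂ λ r r' → pair Q' (ι p r) (ι p' r') ≤ᵐ C
  enabled-lift {C} {p} {p'} enabled with _≟_ Q p p'
  ... | yes refl with sum-≥2 (λ r → C (ι p r)) (enum R) (unique R) (pair-diag-≤⁻ Q enabled)
  ...   | inj₁ (r , 2≤) = r , r , pair-diag-≤ Q' 2≤
  ...   | inj₂ (r , r' , r≢r' , 1≤ , 1≤') = r , r' , pair-≢-≤ Q' (r≢r' ∘ ι-injectiveʳ) 1≤ 1≤'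
  enabled-lift {C} {p} {p'} enabled | no p≢p'
    with pair-≤⁻ Q enabled
  ... | 1≤Kp , 1≤Kp'
    with satisfied (sum-positive (λ r → C (ι p r)) (enum R) 1≤Kp)
       | satisfied (sum-positive (λ r → C (ι p' r)) (enum R) 1≤Kp')
  ... | r , 1≤ | r' , 1≤' = r , r' , pair-≢-≤ Q' (p≢p' ∘ ι-injectiveˡ) 1≤ 1≤'

  samePair-unlift : ∀ {p p' q q' r r'} → SamePair (ι p r) (ι p' r') (ι q r) (ι q' r') → SamePair p p' q q'
  samePair-unlift (inj₁ (e , e')) = inj₁ (ι-injectiveˡ e , ι-injectiveˡ e')
  samePair-unlift (inj₂ (e , e')) = inj₂ (ι-injectiveˡ e , ι-injectiveˡ e')

  project-terminal : ∀ {Σ} (P : Protocol Q Σ) (P' : Protocol Q' Σ) →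
    (∀ {p p' q q'} r r' → T P p p' q q' → T P' (ι p r) (ι p' r') (ι q r) (ι q' r')) →
    ∀ {C} → Terminal P' C → Terminal P (project C)
  project-terminal P P' lift {C} terminal = terminal-if-steps-trivial P step-trivial
    where
    step-trivial : ∀ {X Y} → X ≗ project C → Step P X Y → Y ≗ project C
    step-trivial X≗K (p , p' , q , q' , t , enabled , Y≡) x =
      trans (step-trivial-if-pair-preserved P enabled Y≡ preserved x) (X≗K x)
      where
      enabledK : pair Q p p' ≤ᵐ project C
      enabledK y = subst (pair Q p p' y ≤_) (X≗K y) (enabled y)
      preserved : pair Q p p' ≗ pair Q q q'
      preserved with enabled-lift enabledK
      ... | r , r' , lifted = pair-cong Q (samePair-unlift (pair-injective Q'
                                (terminal-preserves-pair P' terminal (lift r r' t) lifted)))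

corollary2 : ∀ {Q₁ Q₂ : FinSet} {Σ : Set} (P₁ : Protocol Q₁ Σ) (P₂ : Protocol Q₂ Σ)
    (C : Config (Q₁ ×ᶠ Q₂)) → IsPopulation (Q₁ ×ᶠ Q₂) C →
    Terminal (conj P₁ P₂) C →
    Terminal P₁ (π₁ {Q₁} {Q₂} C) × Terminal P₂ (π₂ {Q₁} {Q₂} C)
corollary2 {Q₁} {Q₂} P₁ P₂ C _ terminal =
  project-terminal Q₂ _,_ ,-injectiveˡ ,-injectiveʳ P₁ (conj P₁ P₂)
    (λ _ _ t → inj₁ (t , refl , refl)) terminal ,
  project-terminal Q₁ (flip _,_) ,-injectiveʳ ,-injectiveˡ P₂ (conj P₁ P₂)
    (λ _ _ t → inj₂ (t , refl , refl)) terminal
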